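{- Let $D$ be a Dyck path of semilength $n$, let $j=|D^{(R)}|_u+1$, and let $\sigma=\Phi^{ -1}(D)\in S_n(132)$. Then: (i) if $j\ge 2$, then for every $i\in\{1,\dots,j-1\}$ we have $\sigma(i)\ge j$ and $\sigma^{ -1}(i)\ge j$; (ii) for every $i\ge j$, if $\sigma(i)>i$ then $\sigma^{ -1}(i)<i$.
   Context: A Dyck path of semilength $n$ is a lattice path from $(0,0)$ to $(2n,0)$ with $n$ up-steps $u=(1,1)$ and $n$ down-steps $d=(1,-1)$ never going below the $x$-axis. $D^{(L)}$ and $D^{(R)}$ denote the first $n$ and last $n$ steps of $D$, and $|w|_u$ is the number of up-steps in $w$. In a Dyck path each up-step is matched (by a tunnel) with the first later down-step that ends at the height at which the up-step starts. Label the up-steps from left to right $n,n-1,\dots,1$ and the down-steps from left to right $1,2,\dots,n$; $\Phi^{ -1}(D)$ is the permutation $\tau$ of $[n]$ with $\tau(\ell)=m$ whenever the up-step labelled $\ell$ is matched with the down-step labelled $m$. It is a bijection onto $S_n(132)$, the permutations of $[n]$ avoiding the pattern $132$. -}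

module Defs where

open import Data.Nat using (ℕ; zero; suc; _+_; _*_; _∸_; _<_; _≤_)
open import Data.List using (List; []; _∷_; length; take; drop)
open import Data.Integer using (ℤ; +_; _-_) renaming (_≤_ to _≤ℤ_)
open import Data.Product using (Σ; _×_; ∃)
open import Relation.Binary.PropositionalEquality using (_≡_)
open import Relation.Nullary using (¬_)

-- steps of a lattice path: u = (1,1), d = (1,-1)
data Step : Set where
  u d : Step

ups : List Step → ℕ
ups []       = 0
ups (u ∷ w)  = suc (ups w)
ups (d ∷ w)  = ups w

downs : List Step → ℕ
downs []       = 0
downs (u ∷ w)  = downs w
downs (d ∷ w)  = suc (downs w)

ht : List Step → ℤ
ht w = + ups w - + downs w

IsDyck : ℕ → List Step → Set
IsDyck n D = length D ≡ 2 * n × ups D ≡ n × downs D ≡ n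
           × (∀ k → + 0 ≤ℤ ht (take k D))

-- the step of D at (0-based) position p is s
At : List Step → ℕ → Step → Set
At D p s = Σ (List Step) (λ rest → drop p D ≡ s ∷ rest)

-- Matched n D ℓ m : the up-step of D labelled ℓ is matched (by a tunnel)
-- with the down-step labelled m.  Up-steps are labelled n, n-1, ..., 1 from
-- left to right; down-steps 1, 2, ..., n from left to right.  The up-step at
-- position p (starting at height ht (take p D)) is matched with the first
-- later down-step ending at that height.
Matched : ℕ → List Step → ℕ → ℕ → Set
Matched n D ℓ m =
  Σ ℕ λ p → Σ ℕ λ q →
    p < q × At D p u × At D q d
  × ℓ ≡ n ∸ ups (take p D)
  × m ≡ downs (take (suc q) D)
  × ht (take p D) ≡ ht (take (suc q) D)
  × (∀ r → p < r → r < q → At D r d → ¬ (ht (take p D) ≡ ht (take (suc r) D)))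

-- σ = Φ⁻¹(D) is given by:  σ ℓ ≡ m  iff  Matched n D ℓ m.

-- The proof only uses where the labels of the two halves of D lie.  Up-step
-- labels n ∸ |prefix|_u strictly decrease and down-step labels |prefix|_d
-- increase along the path.  Since D^(L) contains n ∸ K up-steps and K
-- down-steps, an up-step has label > K iff it lies in D^(L), and a down-step
-- has label > K iff it lies in D^(R).  This gives (i) at once.
-- For (ii), let the tunnels (p, q) and (p', q') realise σ(i) = a and
-- σ(b) = i.  The label facts give p < n ≤ q' < q, i.e. the down-step q'
-- lies inside the tunnel (p, q).  Tunnels do not cross (the path stays
-- strictly above the base of a tunnel inside it), so p < p', and the
-- decreasing up-labels give b < i.
module Submission where

open import Defs
open import Data.Nat using (ℕ; zero; suc; _+_; _∸_; _⊓_; _<_; _≤_; z≤n; s≤s)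
import Data.Nat.Properties as ℕₚ
open import Data.List using (List; []; _∷_; _++_; take; drop; length)
open import Data.List.Properties using (take++drop≡id; length-take)
open import Data.Integer using (ℤ; +_; _-_; pred) renaming (suc to sucℤ; _+_ to _+ℤ_; _<_ to _<ℤ_; _≤_ to _≤ℤ_)
import Data.Integer.Properties as ℤₚ
open import Data.Integer.Tactic.RingSolver using (solve-∀)
open import Data.Product using (Σ; _×_; _,_; proj₁; proj₂)
open import Data.Sum using (inj₁; inj₂)
open import Relation.Nullary using (¬_; contradiction)
open import Relation.Binary.PropositionalEquality
open import Relation.Binary.Definitions using (Tri; tri<; tri≈; tri>)

ups-++ : ∀ xs ys → ups (xs ++ ys) ≡ ups xs + ups ys
ups-++ []       ys = refl
ups-++ (u ∷ xs) ys = cong suc (ups-++ xs ys)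
ups-++ (d ∷ xs) ys = ups-++ xs ys

downs-++ : ∀ xs ys → downs (xs ++ ys) ≡ downs xs + downs ys
downs-++ []       ys = refl
downs-++ (u ∷ xs) ys = downs-++ xs ys
downs-++ (d ∷ xs) ys = cong suc (downs-++ xs ys)

ups+downs≡length : ∀ xs → ups xs + downs xs ≡ length xs
ups+downs≡length []       = refl
ups+downs≡length (u ∷ xs) = cong suc (ups+downs≡length xs)
ups+downs≡length (d ∷ xs) = trans (ℕₚ.+-suc (ups xs) (downs xs)) (cong suc (ups+downs≡length xs))

take-suc-At : ∀ r D {s} → At D r s → take (suc r) D ≡ take r D ++ s ∷ []
take-suc-At zero    (x ∷ D) (_ , refl) = refl
take-suc-At (suc r) (x ∷ D) at         = cong (x ∷_) (take-suc-At r D at)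
take-suc-At zero    []      (_ , ())
take-suc-At (suc r) []      (_ , ())

At-≤ : ∀ {r q} D {s} → r ≤ q → At D q s → Σ Step (At D r)
At-≤ {zero}  {q}     (x ∷ D) _         _  = x , D , refl
At-≤ {zero}  {zero}  []      _         (_ , ())
At-≤ {zero}  {suc q} []      _         (_ , ())
At-≤ {suc r} {suc q} []      _         (_ , ())
At-≤ {suc r} {suc q} (x ∷ D) (s≤s r≤q) at = At-≤ D r≤q at

ups-take-mono : ∀ {a b} (xs : List Step) → a ≤ b → ups (take a xs) ≤ ups (take b xs)
ups-take-mono {zero}          xs       _         = z≤n
ups-take-mono {suc a} {suc b} []       _         = z≤n
ups-take-mono {suc a} {suc b} (u ∷ xs) (s≤s a≤b) = s≤s (ups-take-mono xs a≤b)
ups-take-mono {suc a} {suc b} (d ∷ xs) (s≤s a≤b) = ups-take-mono xs a≤b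

downs-take-mono : ∀ {a b} (xs : List Step) → a ≤ b → downs (take a xs) ≤ downs (take b xs)
downs-take-mono {zero}          xs       _         = z≤n
downs-take-mono {suc a} {suc b} []       _         = z≤n
downs-take-mono {suc a} {suc b} (u ∷ xs) (s≤s a≤b) = downs-take-mono xs a≤b
downs-take-mono {suc a} {suc b} (d ∷ xs) (s≤s a≤b) = s≤s (downs-take-mono xs a≤b)

ups-take≤ups : ∀ a (xs : List Step) → ups (take a xs) ≤ ups xs
ups-take≤ups a xs = subst (ups (take a xs) ≤_) (cong ups (take++drop≡id a xs))
  (subst (ups (take a xs) ≤_) (sym (ups-++ (take a xs) (drop a xs))) (ℕₚ.m≤m+n _ _))

ups-take-strict : ∀ {p p'} D → At D p u → p < p' → ups (take p D) < ups (take p' D)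
ups-take-strict {p} {p'} D at-p p<p' =
  subst (_≤ ups (take p' D)) count (ups-take-mono D p<p')
  where
  count : ups (take (suc p) D) ≡ suc (ups (take p D))
  count = begin
    ups (take (suc p) D)              ≡⟨ cong ups (take-suc-At p D at-p) ⟩
    ups (take p D ++ u ∷ [])          ≡⟨ ups-++ (take p D) (u ∷ []) ⟩
    ups (take p D) + 1                ≡⟨ ℕₚ.+-comm (ups (take p D)) 1 ⟩
    suc (ups (take p D))              ∎
    where open ≡-Reasoning

downs-take-strict : ∀ {q q'} D → At D q d → q' ≤ q → downs (take q' D) < downs (take (suc q) D)
downs-take-strict {q} {q'} D at-q q'≤q =
  subst (suc (downs (take q' D)) ≤_) (sym count) (s≤s (downs-take-mono D q'≤q))
  where
  count : downs (take (suc q) D) ≡ suc (downs (take q D))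
  count = begin
    downs (take (suc q) D)            ≡⟨ cong downs (take-suc-At q D at-q) ⟩
    downs (take q D ++ d ∷ [])        ≡⟨ downs-++ (take q D) (d ∷ []) ⟩
    downs (take q D) + 1              ≡⟨ ℕₚ.+-comm (downs (take q D)) 1 ⟩
    suc (downs (take q D))            ∎
    where open ≡-Reasoning

height : List Step → ℕ → ℤ
height D r = ht (take r D)

ht-++ : ∀ xs ys → ht (xs ++ ys) ≡ ht xs +ℤ ht ys
ht-++ xs ys = begin
  + ups (xs ++ ys) - + downs (xs ++ ys)
    ≡⟨ cong₂ (λ a b → + a - + b) (ups-++ xs ys) (downs-++ xs ys) ⟩
  + (ups xs + ups ys) - + (downs xs + downs ys)
    ≡⟨ cong₂ _-_ (ℤₚ.pos-+ (ups xs) (ups ys)) (ℤₚ.pos-+ (downs xs) (downs ys)) ⟩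
  (+ ups xs +ℤ + ups ys) - (+ downs xs +ℤ + downs ys)
    ≡⟨ regroup (+ ups xs) (+ ups ys) (+ downs xs) (+ downs ys) ⟩
  ht xs +ℤ ht ys ∎
  where
  open ≡-Reasoning
  regroup : ∀ (a b c e : ℤ) → (a +ℤ b) - (c +ℤ e) ≡ (a - c) +ℤ (b - e)
  regroup = solve-∀

height-up : ∀ r D → At D r u → height D (suc r) ≡ sucℤ (height D r)
height-up r D at = trans (cong ht (take-suc-At r D at))
  (trans (ht-++ (take r D) (u ∷ [])) (ℤₚ.+-comm (height D r) (+ 1)))

height-down : ∀ r D → At D r d → height D (suc r) ≡ pred (height D r)
height-down r D at = trans (cong ht (take-suc-At r D at))
  (trans (ht-++ (take r D) (d ∷ [])) (ℤₚ.+-comm (height D r) (pred (+ 0))))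

Tunnel : List Step → ℕ → ℕ → Set
Tunnel D p q = At D p u × At D q d × height D p ≡ height D (suc q)
             × (∀ r → p < r → r < q → At D r d → ¬ (height D p ≡ height D (suc r)))

tunnel-above : ∀ {D p q} → Tunnel D p q → ∀ r → p < r → r ≤ q → height D p <ℤ height D r
tunnel-above {D} {p} T@(at-p , at-q , _ , first) (suc r) (s≤s p≤r) r<q
  with ℕₚ.m≤n⇒m<n∨m≡n p≤r
... | inj₂ refl = ℤₚ.suc[i]≤j⇒i<j (ℤₚ.≤-reflexive (sym (height-up p D at-p)))
... | inj₁ p<r with tunnel-above T r p<r (ℕₚ.<⇒≤ r<q) | At-≤ D (ℕₚ.<⇒≤ r<q) at-q
...   | below | u , at-r = ℤₚ.<-≤-trans below
        (subst (height D r ≤ℤ_) (sym (height-up r D at-r)) (ℤₚ.i≤suc[i] _))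
...   | below | d , at-r = ℤₚ.≤∧≢⇒<
        (subst (height D p ≤ℤ_) (sym (height-down r D at-r)) (ℤₚ.i<j⇒i≤pred[j] below))
        (first r p<r r<q at-r)

tunnels-nest : ∀ {D p q p' q'} → Tunnel D p q → Tunnel D p' q' → p ≤ q' → q' < q → p < p'
tunnels-nest {D} {p} {q} {p'} {q'} T T'@(_ , _ , base' , _) p≤q' q'<q = order (ℕₚ.<-cmp p p')
  where
  -- p' starts at the height where q' ends, which is above the base of (p, q).
  p-below-p' : height D p <ℤ height D p'
  p-below-p' = subst (height D p <ℤ_) (sym base') (tunnel-above T (suc q') (s≤s p≤q') q'<q)

  order : Tri (p < p') (p ≡ p') (p' < p) → p < p'
  order (tri< p<p' _ _) = p<p'
  order (tri≈ _ refl _) = contradiction p-below-p' (ℤₚ.<-irrefl refl)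
  order (tri> _ _ p'<p) = contradiction (tunnel-above T' p p'<p p≤q') (ℤₚ.<-asym p-below-p')

upLabel : ℕ → List Step → ℕ → ℕ
upLabel N D p = N ∸ ups (take p D)

downLabel : List Step → ℕ → ℕ
downLabel D q = downs (take (suc q) D)

upLabel-decreasing : ∀ {N p p'} D → At D p u → p < p' → ups (take p' D) ≤ N →
  upLabel N D p' < upLabel N D p
upLabel-decreasing D at-p p<p' bound = ℕₚ.∸-monoʳ-< (ups-take-strict D at-p p<p') bound

module DyckHalves {n : ℕ} {D : List Step} (dyck : IsDyck n D) where

  K : ℕ
  K = ups (drop n D)

  ups-halves : ups (take n D) + K ≡ n
  ups-halves = trans (sym (ups-++ (take n D) (drop n D)))
                     (trans (cong ups (take++drop≡id n D)) (proj₁ (proj₂ dyck)))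

  upLabel-middle : upLabel n D n ≡ K
  upLabel-middle = subst (λ N → N ∸ ups (take n D) ≡ K) ups-halves (ℕₚ.m+n∸m≡n (ups (take n D)) K)

  downs-left : downs (take n D) ≡ K
  downs-left = ℕₚ.+-cancelˡ-≡ (ups (take n D)) (downs (take n D)) K
    (trans (trans (ups+downs≡length (take n D)) length-left) (sym ups-halves))
    where
    length-left : length (take n D) ≡ n
    length-left = trans (length-take n D)
      (trans (cong (n ⊓_) (proj₁ dyck)) (ℕₚ.m≤n⇒m⊓n≡m (ℕₚ.m≤m+n n (n + 0))))

  up-left : ∀ {p} → At D p u → p < n → K < upLabel n D p
  up-left {p} at-p p<n = subst (_< upLabel n D p) upLabel-middle
    (upLabel-decreasing D at-p p<n (subst (ups (take n D) ≤_) ups-halves (ℕₚ.m≤m+n _ K)))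

  up-right : ∀ {p} → n ≤ p → upLabel n D p ≤ K
  up-right {p} n≤p = subst (upLabel n D p ≤_) upLabel-middle (ℕₚ.∸-monoʳ-≤ n (ups-take-mono D n≤p))

  down-left : ∀ {q} → q < n → downLabel D q ≤ K
  down-left {q} q<n = subst (downLabel D q ≤_) downs-left (downs-take-mono D q<n)

  down-right : ∀ {q} → At D q d → n ≤ q → K < downLabel D q
  down-right {q} at-q n≤q = subst (_< downLabel D q) downs-left (downs-take-strict D at-q n≤q)

  up-large⇒left : ∀ {p} → K < upLabel n D p → p < n
  up-large⇒left large = ℕₚ.≰⇒> (λ n≤p → ℕₚ.<⇒≱ large (up-right n≤p))

  up-small⇒right : ∀ {p} → At D p u → upLabel n D p ≤ K → n ≤ p
  up-small⇒right at-p small = ℕₚ.≮⇒≥ (λ p<n → ℕₚ.<⇒≱ (up-left at-p p<n) small)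

  down-large⇒right : ∀ {q} → K < downLabel D q → n ≤ q
  down-large⇒right large = ℕₚ.≮⇒≥ (λ q<n → ℕₚ.<⇒≱ large (down-left q<n))

  down-small⇒left : ∀ {q} → At D q d → downLabel D q ≤ K → q < n
  down-small⇒left at-q small = ℕₚ.≰⇒> (λ n≤q → ℕₚ.<⇒≱ (down-right at-q n≤q) small)

+1≤⇒< : ∀ {k m} → k + 1 ≤ m → k < m
+1≤⇒< {k} {m} = subst (_≤ m) (ℕₚ.+-comm k 1)

<⇒+1≤ : ∀ {k m} → k < m → k + 1 ≤ m
<⇒+1≤ {k} {m} = subst (_≤ m) (ℕₚ.+-comm 1 k)

proposition2p2 : (n : ℕ) (D : List Step) → IsDyck n D →
    ((2 ≤ ups (drop n D) + 1) →
      ∀ i → 1 ≤ i → i ≤ ups (drop n D) →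
        (∀ m → Matched n D i m → ups (drop n D) + 1 ≤ m)
        × (∀ m → Matched n D m i → ups (drop n D) + 1 ≤ m))
    × (∀ i → ups (drop n D) + 1 ≤ i → i ≤ n →
        ∀ a → Matched n D i a → i < a →
        ∀ b → Matched n D b i → b < i)
proposition2p2 n D dyck = (λ _ i _ i≤K → σ[i]≥j i≤K , σ⁻¹[i]≥j i≤K) , part-ii
  where
  open DyckHalves dyck

  -- (i): a label i ≤ K sits on an up-step of D^(R), whose down-step is later,
  -- and on a down-step of D^(L), whose up-step is earlier.
  σ[i]≥j : ∀ {i} → i ≤ K → ∀ m → Matched n D i m → K + 1 ≤ m
  σ[i]≥j i≤K m (p , q , p<q , at-p , at-q , i≡ , m≡ , _) = <⇒+1≤ (subst (K <_) (sym m≡)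
    (down-right at-q (ℕₚ.<⇒≤ (ℕₚ.≤-<-trans (up-small⇒right at-p (subst (_≤ K) i≡ i≤K)) p<q))))

  σ⁻¹[i]≥j : ∀ {i} → i ≤ K → ∀ m → Matched n D m i → K + 1 ≤ m
  σ⁻¹[i]≥j i≤K m (p , q , p<q , at-p , at-q , m≡ , i≡ , _) = <⇒+1≤ (subst (K <_) (sym m≡)
    (up-left at-p (ℕₚ.<-trans p<q (down-small⇒left at-q (subst (_≤ K) i≡ i≤K)))))

  -- (ii): the tunnel (p', q') realising σ(b) = i has its down-step inside the
  -- tunnel (p, q) realising σ(i) = a, hence p < p' and b < i.
  part-ii : ∀ i → K + 1 ≤ i → i ≤ n → ∀ a → Matched n D i a → i < a →
    ∀ b → Matched n D b i → b < i
  part-ii i j≤i _ a (p , q , _ , at-p , at-q , i≡ , a≡ , base , first) i<a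
              b (p' , q' , _ , at-p' , at-q' , b≡ , i≡' , base' , first') =
    subst₂ _<_ (sym b≡) (sym i≡) (upLabel-decreasing D at-p p<p' (ups-take≤n p'))
    where
    p<n : p < n
    p<n = up-large⇒left (subst (K <_) i≡ (+1≤⇒< j≤i))
    n≤q' : n ≤ q'
    n≤q' = down-large⇒right (subst (K <_) i≡' (+1≤⇒< j≤i))
    -- down-step labels increase, and downLabel q' = i < a = downLabel q
    q'<q : q' < q
    q'<q = ℕₚ.≰⇒> (λ q≤q' → ℕₚ.<⇒≱ (subst₂ _<_ i≡' a≡ i<a) (downs-take-mono D (s≤s q≤q')))
    p<p' : p < p'
    p<p' = tunnels-nest (at-p , at-q , base , first) (at-p' , at-q' , base' , first')
                        (ℕₚ.≤-trans (ℕₚ.<⇒≤ p<n) n≤q') q'<q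
    ups-take≤n : ∀ r → ups (take r D) ≤ n
    ups-take≤n r = subst (ups (take r D) ≤_) (proj₁ (proj₂ dyck)) (ups-take≤ups r D)
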